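{- Let $G$ be a graph of order $n\ge 3$. Then $\operatorname{th_{dim}}(G)=n-1$ if and only if among every three distinct vertices of $G$ there exist two, say $x$ and $y$, with the third denoted $z$, such that $N(x)\setminus\{y,z\}=N(y)\setminus\{x,z\}$.
   Context: All graphs are finite and simple; $N(v)$ is the (open) neighborhood of $v$. $\operatorname{dist}(u,v)$ is the shortest-path distance ($\infty$ across components). For a nonnegative integer $r$, $\operatorname{dist}_r(x,v)=\min(\operatorname{dist}(x,v),r+1)$. A set $S\subseteq V(G)$ is a distance-$r$ resolving set if for all distinct $x,y\in V(G)$ there is $v\in S$ with $\operatorname{dist}_r(v,x)\ne\operatorname{dist}_r(v,y)$. $\dim_r(G)$ is the minimum size of such a set and $\operatorname{th_{dim}}(G)=\min_{r\ge0}(r+\dim_r(G))$ over nonnegative integers $r$. -}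

module Defs where

open import Data.Nat using (ℕ; zero; suc; _+_; _≤_)
open import Data.Bool using (Bool; true; false; if_then_else_; _∨_; _∧_)
open import Data.Fin using (Fin; _≟_)
open import Data.Fin.Subset using (Subset; _∈_; ∣_∣)
open import Data.List using (allFin)
open import Data.Bool.ListAction using (any)
open import Data.Product using (Σ; ∃; _×_; _,_)
open import Data.Sum using (_⊎_)
open import Relation.Nullary using (¬_)
open import Relation.Nullary.Decidable using (⌊_⌋)
open import Relation.Binary.PropositionalEquality using (_≡_; _≢_)

record Graph (n : ℕ) : Set where
  field
    adj     : Fin n → Fin n → Bool
    symm    : ∀ x y → adj x y ≡ adj y x
    irrefl  : ∀ x → adj x x ≡ false
open Graph public

module _ {n : ℕ} (G : Graph n) where

  reach : ℕ → Fin n → Fin n → Bool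
  reach zero    x v = ⌊ x ≟ v ⌋
  reach (suc k) x v = reach k x v ∨ any (λ u → reach k x u ∧ adj G u v) (allFin n)

  leastUpTo : (ℕ → Bool) → ℕ → ℕ
  leastUpTo p zero    = if p zero then zero else suc zero
  leastUpTo p (suc r) = if p zero then zero else suc (leastUpTo (λ k → p (suc k)) r)

  -- dist_r(x,v) = min(dist(x,v), r+1)
  distR : ℕ → Fin n → Fin n → ℕ
  distR r x v = leastUpTo (λ k → reach k x v) r

  IsResolving : ℕ → Subset n → Set
  IsResolving r S = ∀ x y → x ≢ y → Σ (Fin n) λ v → v ∈ S × distR r v x ≢ distR r v y

  IsDimR : ℕ → ℕ → Set
  IsDimR r d = (Σ (Subset n) λ S → IsResolving r S × ∣ S ∣ ≡ d)
             × (∀ S → IsResolving r S → d ≤ ∣ S ∣)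

  IsThDim : ℕ → Set
  IsThDim t = (Σ ℕ λ r → Σ ℕ λ d → IsDimR r d × t ≡ r + d)
            × (∀ r d → IsDimR r d → t ≤ r + d)

  TwinCond : Fin n → Fin n → Fin n → Set
  TwinCond x y z =
      (∀ w → adj G x w ≡ true → w ≢ y → w ≢ z → adj G y w ≡ true × w ≢ x × w ≢ z)
    × (∀ w → adj G y w ≡ true → w ≢ x → w ≢ z → adj G x w ≡ true × w ≢ y × w ≢ z)

  TripleCond : Set
  TripleCond = ∀ a b c → a ≢ b → a ≢ c → b ≢ c →
    TwinCond a b c ⊎ TwinCond a c b ⊎ TwinCond b c a

-- Call x and y twins if N(x) ∖ {y} = N(y) ∖ {x}. Swapping twins is an
-- automorphism, so no third vertex tells them apart at any distance, and
-- every resolving set contains one of any two twins. A 0-resolving set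
-- misses at most one vertex. Under the triple condition a 1-resolving set
-- misses at most two, because at distance ≤ 1 a vertex only sees adjacency,
-- and any resolving set misses at most three, because four vertices avoiding
-- a fifth always contain twins. Hence r + dim_r(G) ≥ n − 1 for every r, with
-- equality at r = 0. Conversely, if each pair of a triple {a, b, c} is
-- separated by a vertex outside the triple, then V ∖ {a, b, c} is
-- 1-resolving, so th_dim(G) ≤ 1 + (n − 3).

module Submission where

open import Defs
open import Data.Nat using (ℕ; _≤_; _∸_)
open import Function.Bundles using (_⇔_)

open import Data.Bool using (Bool; true; false; T; if_then_else_; _∧_; _∨_)
import Data.Bool as Bool
open import Data.Bool.ListAction using (any; or)
open import Data.Bool.Properties using (T-∧)
open import Data.Empty using (⊥; ⊥-elim)
open import Data.Fin using (Fin; _≟_)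
import Data.Fin as Fin
open import Data.Fin.Patterns using (0F; 1F; 2F; 3F)
open import Data.Fin.Permutation using (Permutation′; _⟨$⟩ʳ_; _⟨$⟩ˡ_; inverseʳ; transpose)
open import Data.Fin.Properties using (suc-injective; any?; all?)
open import Data.Fin.Subset using (Subset; _∈_; _∉_; ∣_∣; inside; outside; ⁅_⁆; _∪_; ∁)
open import Data.Fin.Subset.Properties
  using (_∈?_; anySubset?; x∈⁅x⁆; x∈⁅y⁆⇒x≡y; x≢y⇒x∉⁅y⁆; x∈p∪q⁺; x∈p∪q⁻; q⊆p∪q;
         x∉∁p⇒x∈p; x∉p⇒x∈∁p; ∣∁p∣≡n∸∣p∣; ∣⁅x⁆∣≡1; p⊂q⇒∣p∣<∣q∣)
open import Data.List using (allFin)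
open import Data.List.Membership.Propositional.Properties using (∈-allFin)
open import Data.List.Properties using (map-cong)
import Data.List.Relation.Unary.Any as Any
open import Data.List.Relation.Unary.Any.Properties using (any⁺; any⁻)
open import Data.Nat using (zero; suc; _<_; _+_; z≤n; s≤s; s≤s⁻¹)
import Data.Nat as ℕ
open import Data.Nat.Induction using (<-rec)
open import Data.Nat.Properties
  using (anyUpTo?; ≮⇒≥; ≰⇒>; 1+n≰n; +-suc; +-monoˡ-≤; ∸-monoˡ-≤; ∸-monoʳ-≤; ≤-trans;
         module ≤-Reasoning)
open import Data.Product using (∃; _×_; _,_; proj₁)
open import Data.Sum using (_⊎_; inj₁; inj₂)
import Data.Sum as Sum
open import Data.Vec using ([]; _∷_; there)
open import Function.Base using (_∘_; case_of_)
open import Function.Bundles using (mk⇔; Injection; Equivalence)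
open import Function.Definitions using (Injective)
open import Function.Properties.Inverse using (↔⇒↣)
open import Relation.Binary.PropositionalEquality
  using (_≡_; _≢_; refl; sym; trans; cong; cong₂; subst; ≢-sym; ≡-≟-identity; ≢-≟-identity;
         module ≡-Reasoning)
open import Relation.Nullary using (Dec; yes; no; ¬_)
open import Relation.Nullary.Decidable
  using (⌊_⌋; ¬?; _×-dec_; _→-dec_; decidable-stable; dec-true; dec-false; toWitness; fromWitness)
open import Relation.Unary using (Pred; Decidable)

T-injective : ∀ {a b} → (T a → T b) → (T b → T a) → a ≡ b
T-injective {false} {false} _ _ = refl
T-injective {false} {true}  _ g = ⊥-elim (g _)
T-injective {true}  {false} f _ = ⊥-elim (f _)
T-injective {true}  {true}  _ _ = refl

T-any-allFin⁻ : ∀ {n} (f : Fin n → Bool) → T (any f (allFin n)) → ∃ λ i → T (f i)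
T-any-allFin⁻ {n} f t = Any.satisfied (any⁻ f (allFin n) t)

T-any-allFin⁺ : ∀ {n} (f : Fin n → Bool) i → T (f i) → T (any f (allFin n))
T-any-allFin⁺ f i t = any⁺ f (Any.map (λ { refl → t }) (∈-allFin i))

any-cong : ∀ {n} {f g : Fin n → Bool} → (∀ i → f i ≡ g i) → any f (allFin n) ≡ any g (allFin n)
any-cong {n} f≗g = cong or (map-cong f≗g (allFin n))

any-permute : ∀ {n} (π : Permutation′ n) (f : Fin n → Bool) →
  any (λ i → f (π ⟨$⟩ʳ i)) (allFin n) ≡ any f (allFin n)
any-permute π f = T-injective
  (λ t → let i , fπi = T-any-allFin⁻ (λ j → f (π ⟨$⟩ʳ j)) t in T-any-allFin⁺ f _ fπi)
  (λ t → let i , fi = T-any-allFin⁻ f t in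
    T-any-allFin⁺ (λ j → f (π ⟨$⟩ʳ j)) (π ⟨$⟩ˡ i) (subst (T ∘ f) (sym (inverseʳ π)) fi))

any-≟∧ : ∀ {n} (v : Fin n) (f : Fin n → Bool) → any (λ u → ⌊ v ≟ u ⌋ ∧ f u) (allFin n) ≡ f v
any-≟∧ {n} v f = T-injective
  (λ t → let u , t′ = T-any-allFin⁻ v≟∧f t ; v≡u , fu = Equivalence.to T-∧ t′
         in subst (T ∘ f) (sym (toWitness v≡u)) fu)
  (λ fv → T-any-allFin⁺ v≟∧f v (Equivalence.from T-∧ (fromWitness refl , fv)))
  where
  v≟∧f : Fin n → Bool
  v≟∧f u = ⌊ v ≟ u ⌋ ∧ f u

module _ {p} {P : Pred ℕ p} (P? : Decidable P) where

  Least : Set p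
  Least = ∃ λ i → P i × (∀ {j} → P j → i ≤ j)

  least : ∀ {m} → P m → Least
  least {m} = <-rec (λ m → P m → Least) step m
    where
    step : ∀ m → (∀ {k} → k < m → P k → Least) → P m → Least
    step m smaller Pm with anyUpTo? P? m
    ... | yes (k , k<m , Pk) = smaller k<m Pk
    ... | no none            = m , Pm , λ Pj → ≮⇒≥ λ j<m → none (_ , j<m , Pj)

module _ {n : ℕ} where

  ∈∉⇒≢ : ∀ {S : Subset n} {v x} → v ∈ S → x ∉ S → v ≢ x
  ∈∉⇒≢ v∈S x∉S refl = x∉S v∈S

  x∉∁⁅y⁆⇒x≡y : ∀ {x y : Fin n} → x ∉ ∁ ⁅ y ⁆ → x ≡ y
  x∉∁⁅y⁆⇒x≡y x∉ = x∈⁅y⁆⇒x≡y _ (x∉∁p⇒x∈p x∉)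

  ∣∁⁅x⁆∣≡n∸1 : ∀ (x : Fin n) → ∣ ∁ ⁅ x ⁆ ∣ ≡ n ∸ 1
  ∣∁⁅x⁆∣≡n∸1 x = trans (∣∁p∣≡n∸∣p∣ ⁅ x ⁆) (cong (n ∸_) (∣⁅x⁆∣≡1 x))

  x∉p⇒∣p∣<∣⁅x⁆∪p∣ : ∀ {x : Fin n} {p} → x ∉ p → ∣ p ∣ < ∣ ⁅ x ⁆ ∪ p ∣
  x∉p⇒∣p∣<∣⁅x⁆∪p∣ {x} x∉p = p⊂q⇒∣p∣<∣q∣ (q⊆p∪q _ _ , x , x∈p∪q⁺ (inj₁ (x∈⁅x⁆ x)) , x∉p)

  x∈⁅a⁆∪⁅b⁆∪⁅c⁆⁻ : ∀ {x a b c : Fin n} → x ∈ ⁅ a ⁆ ∪ ⁅ b ⁆ ∪ ⁅ c ⁆ → x ≡ a ⊎ x ≡ b ⊎ x ≡ c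
  x∈⁅a⁆∪⁅b⁆∪⁅c⁆⁻ {a = a} {b} {c} x∈ =
    Sum.map (x∈⁅y⁆⇒x≡y a) (Sum.map (x∈⁅y⁆⇒x≡y b) (x∈⁅y⁆⇒x≡y c) ∘ x∈p∪q⁻ _ _) (x∈p∪q⁻ _ _ x∈)

  x∉p∪q : ∀ {x : Fin n} {p q} → x ∉ p → x ∉ q → x ∉ p ∪ q
  x∉p∪q x∉p x∉q = Sum.[ x∉p , x∉q ] ∘ x∈p∪q⁻ _ _

  x∉⁅a⁆∪⁅b⁆∪⁅c⁆ : ∀ {x a b c : Fin n} → x ≢ a → x ≢ b → x ≢ c → x ∉ ⁅ a ⁆ ∪ ⁅ b ⁆ ∪ ⁅ c ⁆
  x∉⁅a⁆∪⁅b⁆∪⁅c⁆ x≢a x≢b x≢c = x∉p∪q (x≢y⇒x∉⁅y⁆ x≢a) (x∉p∪q (x≢y⇒x∉⁅y⁆ x≢b) (x≢y⇒x∉⁅y⁆ x≢c))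

  ∣∁⁅a⁆∪⁅b⁆∪⁅c⁆∣≤n∸3 : ∀ {a b c : Fin n} → a ≢ b → a ≢ c → b ≢ c →
    ∣ ∁ (⁅ a ⁆ ∪ ⁅ b ⁆ ∪ ⁅ c ⁆) ∣ ≤ n ∸ 3
  ∣∁⁅a⁆∪⁅b⁆∪⁅c⁆∣≤n∸3 {a} {b} {c} a≢b a≢c b≢c = begin
    ∣ ∁ (⁅ a ⁆ ∪ ⁅ b ⁆ ∪ ⁅ c ⁆) ∣ ≡⟨ ∣∁p∣≡n∸∣p∣ (⁅ a ⁆ ∪ ⁅ b ⁆ ∪ ⁅ c ⁆) ⟩
    n ∸ ∣ ⁅ a ⁆ ∪ ⁅ b ⁆ ∪ ⁅ c ⁆ ∣   ≤⟨ ∸-monoʳ-≤ n three≤ ⟩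
    n ∸ 3                          ∎
    where
    open ≤-Reasoning
    three≤ : 3 ≤ ∣ ⁅ a ⁆ ∪ ⁅ b ⁆ ∪ ⁅ c ⁆ ∣
    three≤ = ≤-trans
      (s≤s (subst (_< ∣ ⁅ b ⁆ ∪ ⁅ c ⁆ ∣) (∣⁅x⁆∣≡1 c) (x∉p⇒∣p∣<∣⁅x⁆∪p∣ (x≢y⇒x∉⁅y⁆ b≢c))))
      (x∉p⇒∣p∣<∣⁅x⁆∪p∣ (x∉p∪q (x≢y⇒x∉⁅y⁆ a≢b) (x≢y⇒x∉⁅y⁆ a≢c)))

record Outside {n} (k : ℕ) (S : Subset n) : Set where
  field
    point     : Fin k → Fin n
    injective : Injective _≡_ _≡_ point
    point∉    : ∀ i → point i ∉ S

  point-≢ : ∀ {i j} → i ≢ j → point i ≢ point j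
  point-≢ i≢j = i≢j ∘ injective

outside⁺ : ∀ {n k} (S : Subset n) → k + ∣ S ∣ ≤ n → Outside k S
outside⁺ {k = zero} S _ = record { point = λ () ; injective = λ { {()} } ; point∉ = λ () }
outside⁺ {k = suc k} [] ()
outside⁺ {k = suc k} (outside ∷ S) (s≤s k+∣S∣≤n) = record
  { point = point′ ; injective = injective′ ; point∉ = point∉′ }
  where
  open Outside (outside⁺ S k+∣S∣≤n)
  point′ : Fin (suc k) → Fin _
  point′ Fin.zero    = Fin.zero
  point′ (Fin.suc i) = Fin.suc (point i)
  injective′ : Injective _≡_ _≡_ point′
  injective′ {Fin.zero}  {Fin.zero}  _ = refl
  injective′ {Fin.suc i} {Fin.suc j} e = cong Fin.suc (injective (suc-injective e))
  point∉′ : ∀ i → point′ i ∉ outside ∷ S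
  point∉′ Fin.zero    ()
  point∉′ (Fin.suc i) (there p) = point∉ i p
outside⁺ {suc n} {k} (inside ∷ S) k+∣S∣<n = record
  { point = Fin.suc ∘ point
  ; injective = injective ∘ suc-injective
  ; point∉ = λ { i (there p) → point∉ i p }
  }
  where open Outside (outside⁺ S (s≤s⁻¹ (subst (_≤ suc n) (+-suc k ∣ S ∣) k+∣S∣<n)))

outside-bound : ∀ {n} k (S : Subset n) → ¬ Outside (2 + k) S → n ∸ 1 ≤ k + ∣ S ∣
outside-bound k S no-outside = ∸-monoˡ-≤ 1 (s≤s⁻¹ (≰⇒> (no-outside ∘ outside⁺ S)))

transpose-matchˡ : ∀ {n} (i j : Fin n) → transpose i j ⟨$⟩ʳ i ≡ j
transpose-matchˡ i j rewrite dec-true (i ≟ i) refl = refl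

transpose-matchʳ : ∀ {n} (i j : Fin n) → transpose i j ⟨$⟩ʳ j ≡ i
transpose-matchʳ i j with j ≟ i
... | yes j≡i = j≡i
... | no  _   rewrite dec-true (j ≟ j) refl = refl

transpose-mismatch : ∀ {n} {i j k : Fin n} → k ≢ i → k ≢ j → transpose i j ⟨$⟩ʳ k ≡ k
transpose-mismatch {i = i} {j} {k} k≢i k≢j
  rewrite dec-false (k ≟ i) k≢i | dec-false (k ≟ j) k≢j = refl

module _ {n : ℕ} (G : Graph n) where

  reach₀-refl : ∀ x → reach G 0 x x ≡ true
  reach₀-refl x rewrite ≡-≟-identity _≟_ {x} refl = refl

  reach₀-≢ : ∀ {x y} → x ≢ y → reach G 0 x y ≡ false
  reach₀-≢ x≢y rewrite ≢-≟-identity _≟_ x≢y = refl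

  distR-refl : ∀ r x → distR G r x x ≡ 0
  distR-refl zero    x rewrite reach₀-refl x = refl
  distR-refl (suc r) x rewrite reach₀-refl x = refl

  distR-≢0 : ∀ r {x y} → x ≢ y → distR G r x y ≢ 0
  distR-≢0 zero    x≢y rewrite reach₀-≢ x≢y = λ ()
  distR-≢0 (suc r) x≢y rewrite reach₀-≢ x≢y = λ ()

  distR₀-≢ : ∀ {x y} → x ≢ y → distR G 0 x y ≡ 1
  distR₀-≢ x≢y rewrite reach₀-≢ x≢y = refl

  distR₁-≢ : ∀ {x y} → x ≢ y → distR G 1 x y ≡ suc (if adj G x y then 0 else 1)
  distR₁-≢ {x} {y} x≢y rewrite reach₀-≢ x≢y =
    cong (λ b → suc (if b then 0 else 1)) (any-≟∧ x (λ u → adj G u y))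

  distR₁-≡⇔adj-≡ : ∀ {v x y} → v ≢ x → v ≢ y →
    (distR G 1 v x ≡ distR G 1 v y) ⇔ (adj G v x ≡ adj G v y)
  distR₁-≡⇔adj-≡ {v} {x} {y} v≢x v≢y rewrite distR₁-≢ v≢x | distR₁-≢ v≢y =
    mk⇔ (if-injective (adj G v x) (adj G v y)) (cong λ b → suc (if b then 0 else 1))
    where
    if-injective : ∀ a b → suc (if a then 0 else 1) ≡ suc (if b then 0 else 1) → a ≡ b
    if-injective false false _  = refl
    if-injective false true  ()
    if-injective true  false ()
    if-injective true  true  _  = refl

  leastUpTo-cong : ∀ {p q : ℕ → Bool} → (∀ k → p k ≡ q k) → ∀ r →
    leastUpTo G p r ≡ leastUpTo G q r
  leastUpTo-cong p≗q zero    = cong (λ b → if b then 0 else 1) (p≗q 0)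
  leastUpTo-cong p≗q (suc r) =
    cong₂ (λ b m → if b then 0 else suc m) (p≗q 0) (leastUpTo-cong (p≗q ∘ suc) r)

  -- Automorphisms and twins

  IsAutomorphism : Permutation′ n → Set
  IsAutomorphism π = ∀ u v → adj G (π ⟨$⟩ʳ u) (π ⟨$⟩ʳ v) ≡ adj G u v

  module _ {π : Permutation′ n} (π-aut : IsAutomorphism π) where

    reach-automorphism : ∀ k u v → reach G k (π ⟨$⟩ʳ u) (π ⟨$⟩ʳ v) ≡ reach G k u v
    reach-automorphism zero u v with u ≟ v
    ... | yes refl = reach₀-refl (π ⟨$⟩ʳ u)
    ... | no  u≢v  = reach₀-≢ (u≢v ∘ Injection.injective (↔⇒↣ π))
    reach-automorphism (suc k) u v = cong₂ _∨_ (reach-automorphism k u v) (begin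
      any (λ w → reach G k (π ⟨$⟩ʳ u) w ∧ adj G w (π ⟨$⟩ʳ v)) (allFin n)
        ≡⟨ any-permute π (λ w → reach G k (π ⟨$⟩ʳ u) w ∧ adj G w (π ⟨$⟩ʳ v)) ⟨
      any (λ w → reach G k (π ⟨$⟩ʳ u) (π ⟨$⟩ʳ w) ∧ adj G (π ⟨$⟩ʳ w) (π ⟨$⟩ʳ v)) (allFin n)
        ≡⟨ any-cong (λ w → cong₂ _∧_ (reach-automorphism k u w) (π-aut w v)) ⟩
      any (λ w → reach G k u w ∧ adj G w v) (allFin n) ∎)
      where open ≡-Reasoning

    distR-automorphism : ∀ r u v → distR G r (π ⟨$⟩ʳ u) (π ⟨$⟩ʳ v) ≡ distR G r u v
    distR-automorphism r u v = leastUpTo-cong (λ k → reach-automorphism k u v) r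

  Twins : Fin n → Fin n → Set
  Twins x y = ∀ w → w ≢ x → w ≢ y → adj G x w ≡ adj G y w

  data Position (x y : Fin n) : Fin n → Set where
    at-x      : Position x y x
    at-y      : Position x y y
    elsewhere : ∀ {w} → w ≢ x → w ≢ y → Position x y w

  position : ∀ x y w → Position x y w
  position x y w with w ≟ x | w ≟ y
  ... | yes refl | _        = at-x
  ... | no  _    | yes refl = at-y
  ... | no  w≢x  | no  w≢y  = elsewhere w≢x w≢y

  transpose-automorphism : ∀ {x y} → Twins x y → IsAutomorphism (transpose x y)
  transpose-automorphism {x} {y} twins u v with position x y u | position x y v
  ... | at-x | at-x rewrite transpose-matchˡ x y = trans (irrefl G y) (sym (irrefl G x))
  ... | at-x | at-y rewrite transpose-matchˡ x y | transpose-matchʳ x y = symm G y x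
  ... | at-y | at-x rewrite transpose-matchˡ x y | transpose-matchʳ x y = symm G x y
  ... | at-y | at-y rewrite transpose-matchʳ x y = trans (irrefl G x) (sym (irrefl G y))
  ... | at-x | elsewhere v≢x v≢y rewrite transpose-matchˡ x y | transpose-mismatch v≢x v≢y =
    sym (twins v v≢x v≢y)
  ... | at-y | elsewhere v≢x v≢y rewrite transpose-matchʳ x y | transpose-mismatch v≢x v≢y =
    twins v v≢x v≢y
  ... | elsewhere u≢x u≢y | at-x rewrite transpose-matchˡ x y | transpose-mismatch u≢x u≢y =
    trans (symm G u y) (trans (sym (twins u u≢x u≢y)) (symm G x u))
  ... | elsewhere u≢x u≢y | at-y rewrite transpose-matchʳ x y | transpose-mismatch u≢x u≢y =
    trans (symm G u x) (trans (twins u u≢x u≢y) (symm G y u))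
  ... | elsewhere u≢x u≢y | elsewhere v≢x v≢y
    rewrite transpose-mismatch u≢x u≢y | transpose-mismatch v≢x v≢y = refl

  distR-twins : ∀ {x y v} → Twins x y → v ≢ x → v ≢ y → ∀ r → distR G r v x ≡ distR G r v y
  distR-twins {x} {y} {v} twins v≢x v≢y r = begin
    distR G r v x
      ≡⟨ distR-automorphism {transpose x y} (transpose-automorphism twins) r v x ⟨
    distR G r (transpose x y ⟨$⟩ʳ v) (transpose x y ⟨$⟩ʳ x)
      ≡⟨ cong₂ (distR G r) (transpose-mismatch v≢x v≢y) (transpose-matchˡ x y) ⟩
    distR G r v y ∎
    where open ≡-Reasoning

  ¬twins⇒≢ : ∀ {x y} → ¬ Twins x y → x ≢ y
  ¬twins⇒≢ ¬twins refl = ¬twins λ _ _ _ → refl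

  ¬twins-sym : ∀ {x y} → ¬ Twins x y → ¬ Twins y x
  ¬twins-sym ¬twins twins = ¬twins λ w w≢x w≢y → sym (twins w w≢y w≢x)

  -- The triple condition

  TwinsModulo : Fin n → Fin n → Fin n → Set
  TwinsModulo x y z = ∀ w → w ≢ x → w ≢ y → w ≢ z → adj G x w ≡ adj G y w

  adj⇒≢ : ∀ {x w} → adj G x w ≡ true → w ≢ x
  adj⇒≢ {x} x~w refl = case trans (sym x~w) (irrefl G x) of λ ()

  twinCond⇔twinsModulo : ∀ {x y z} → TwinCond G x y z ⇔ TwinsModulo x y z
  twinCond⇔twinsModulo {x} {y} {z} = mk⇔ to from
    where
    to : TwinCond G x y z → TwinsModulo x y z
    to (x⊆y , y⊆x) w w≢x w≢y w≢z with adj G x w in x~w | adj G y w in y~w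
    ... | true  | true  = refl
    ... | false | false = refl
    ... | true  | false = trans (sym (proj₁ (x⊆y w x~w w≢y w≢z))) y~w
    ... | false | true  = trans (sym x~w) (proj₁ (y⊆x w y~w w≢x w≢z))
    from : TwinsModulo x y z → TwinCond G x y z
    from xy∣z = (λ w x~w w≢y w≢z → let w≢x = adj⇒≢ x~w in
                  trans (sym (xy∣z w w≢x w≢y w≢z)) x~w , w≢x , w≢z)
              , (λ w y~w w≢x w≢z → let w≢y = adj⇒≢ y~w in
                  trans (xy∣z w w≢x w≢y w≢z) y~w , w≢y , w≢z)

  twinsModulo-sym : ∀ {x y z} → TwinsModulo x y z → TwinsModulo y x z
  twinsModulo-sym xy∣z w w≢y w≢x w≢z = sym (xy∣z w w≢x w≢y w≢z)

  twinsModulo₂⇒twins : ∀ {x y z z′} → TwinsModulo x y z → TwinsModulo x y z′ → z ≢ z′ →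
    Twins x y
  twinsModulo₂⇒twins {z = z} xy∣z xy∣z′ z≢z′ w w≢x w≢y with w ≟ z
  ... | yes refl = xy∣z′ w w≢x w≢y z≢z′
  ... | no  w≢z  = xy∣z w w≢x w≢y w≢z

  twinsModulo∧¬twins⇒adj-≢ : ∀ {x y z} → TwinsModulo x y z → ¬ Twins x y →
    adj G x z ≢ adj G y z
  twinsModulo∧¬twins⇒adj-≢ {z = z} xy∣z ¬twins xz≡yz = ¬twins λ w w≢x w≢y →
    case w ≟ z of λ where
      (yes refl) → xz≡yz
      (no  w≢z)  → xy∣z w w≢x w≢y w≢z

  tripleCond⇒twinsModulo : TripleCond G → ∀ {a b c} → a ≢ b → a ≢ c → b ≢ c →
    TwinsModulo a b c ⊎ TwinsModulo a c b ⊎ TwinsModulo b c a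
  tripleCond⇒twinsModulo tc {a} {b} {c} a≢b a≢c b≢c =
    Sum.map to (Sum.map to to) (tc a b c a≢b a≢c b≢c)
    where
    to : ∀ {x y z} → TwinCond G x y z → TwinsModulo x y z
    to = Equivalence.to twinCond⇔twinsModulo

  -- The fifth vertex v cannot be dropped: the path a – b – c – d satisfies
  -- the triple condition but contains no twins.
  module _ (tc : TripleCond G) {v : Fin n} where

    -- v sees c and d exactly as a does; with this, each outcome of the
    -- triple condition on {a, c, d} yields twins.
    twinsModulo-chain-absurd : ∀ {a b c d} → v ≢ a → v ≢ b → v ≢ c → v ≢ d →
      ¬ Twins a b → ¬ Twins a c → ¬ Twins a d → ¬ Twins b c → ¬ Twins b d → ¬ Twins c d →
      TwinsModulo a b c → TwinsModulo a d b → ⊥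
    twinsModulo-chain-absurd {a} {b} {c} {d} v≢a v≢b v≢c v≢d ¬ab ¬ac ¬ad ¬bc ¬bd ¬cd ab∣c ad∣b =
      contradiction
      where
      open ≡-Reasoning
      a≢b : a ≢ b
      a≢b = ¬twins⇒≢ ¬ab
      a≢c : a ≢ c
      a≢c = ¬twins⇒≢ ¬ac
      a≢d : a ≢ d
      a≢d = ¬twins⇒≢ ¬ad
      b≢c : b ≢ c
      b≢c = ¬twins⇒≢ ¬bc
      b≢d : b ≢ d
      b≢d = ¬twins⇒≢ ¬bd
      c≢d : c ≢ d
      c≢d = ¬twins⇒≢ ¬cd
      ac≢bc : adj G a c ≢ adj G b c
      ac≢bc = twinsModulo∧¬twins⇒adj-≢ ab∣c ¬ab
      ab≢db : adj G a b ≢ adj G d b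
      ab≢db = twinsModulo∧¬twins⇒adj-≢ ad∣b ¬ad
      ac≡dc : adj G a c ≡ adj G d c
      ac≡dc = ad∣b c (≢-sym a≢c) c≢d (≢-sym b≢c)
      av≡dv : adj G a v ≡ adj G d v
      av≡dv = ad∣b v v≢a v≢d v≢b
      ac≡vc : adj G a c ≡ adj G v c
      ac≡vc with tripleCond⇒twinsModulo tc a≢d (≢-sym v≢a) (≢-sym v≢d)
      ... | inj₁ ad∣v        = ⊥-elim (ab≢db (ad∣v b (≢-sym a≢b) b≢d (≢-sym v≢b)))
      ... | inj₂ (inj₁ av∣d) = av∣d c (≢-sym a≢c) (≢-sym v≢c) c≢d
      ... | inj₂ (inj₂ dv∣a) = trans ac≡dc (dv∣a c c≢d (≢-sym v≢c) (≢-sym a≢c))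
      ad≡vd : adj G a d ≡ adj G v d
      ad≡vd with tripleCond⇒twinsModulo tc a≢b (≢-sym v≢a) (≢-sym v≢b)
      ... | inj₁ ab∣v        = ⊥-elim (ac≢bc (ab∣v c (≢-sym a≢c) (≢-sym b≢c) (≢-sym v≢c)))
      ... | inj₂ (inj₁ av∣b) = av∣b d (≢-sym a≢d) (≢-sym v≢d) (≢-sym b≢d)
      ... | inj₂ (inj₂ bv∣a) =
        ⊥-elim (ac≢bc (trans ac≡vc (sym (bv∣a c (≢-sym b≢c) (≢-sym v≢c) (≢-sym a≢c)))))
      contradiction : ⊥
      contradiction with tripleCond⇒twinsModulo tc a≢c a≢d c≢d
      ... | inj₁ ac∣d = twinsModulo∧¬twins⇒adj-≢ ac∣d ¬ac (begin
        adj G a d ≡⟨ ad≡vd ⟩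
        adj G v d ≡⟨ symm G v d ⟩
        adj G d v ≡⟨ av≡dv ⟨
        adj G a v ≡⟨ ac∣d v v≢a v≢c v≢d ⟩
        adj G c v ≡⟨ symm G c v ⟩
        adj G v c ≡⟨ ac≡vc ⟨
        adj G a c ≡⟨ ac≡dc ⟩
        adj G d c ≡⟨ symm G d c ⟩
        adj G c d ∎)
      ... | inj₂ (inj₁ ad∣c) = ¬ad (twinsModulo₂⇒twins ad∣b ad∣c b≢c)
      ... | inj₂ (inj₂ cd∣a) = twinsModulo∧¬twins⇒adj-≢ cd∣a ¬cd (begin
        adj G c a ≡⟨ symm G c a ⟩
        adj G a c ≡⟨ ac≡vc ⟩
        adj G v c ≡⟨ symm G v c ⟩
        adj G c v ≡⟨ cd∣a v v≢c v≢d v≢a ⟩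
        adj G d v ≡⟨ symm G d v ⟩
        adj G v d ≡⟨ ad≡vd ⟨
        adj G a d ≡⟨ symm G a d ⟩
        adj G d a ∎)

    twinsModulo-absurd : ∀ {x y z w} → v ≢ x → v ≢ y → v ≢ z → v ≢ w →
      ¬ Twins x y → ¬ Twins x z → ¬ Twins x w → ¬ Twins y z → ¬ Twins y w → ¬ Twins z w →
      TwinsModulo x y z → ⊥
    twinsModulo-absurd v≢x v≢y v≢z v≢w ¬xy ¬xz ¬xw ¬yz ¬yw ¬zw xy∣z
      with tripleCond⇒twinsModulo tc (¬twins⇒≢ ¬xy) (¬twins⇒≢ ¬xw) (¬twins⇒≢ ¬yw)
    ... | inj₁ xy∣w        = ¬xy (twinsModulo₂⇒twins xy∣z xy∣w (¬twins⇒≢ ¬zw))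
    ... | inj₂ (inj₁ xw∣y) =
      twinsModulo-chain-absurd v≢x v≢y v≢z v≢w ¬xy ¬xz ¬xw ¬yz ¬yw ¬zw xy∣z xw∣y
    ... | inj₂ (inj₂ yw∣x) =
      twinsModulo-chain-absurd v≢y v≢x v≢z v≢w (¬twins-sym ¬xy) ¬yz ¬yw ¬xz ¬xw ¬zw
        (twinsModulo-sym xy∣z) yw∣x

    twin-free-four-absurd : ∀ {a b c d} → v ≢ a → v ≢ b → v ≢ c → v ≢ d →
      ¬ Twins a b → ¬ Twins a c → ¬ Twins a d → ¬ Twins b c → ¬ Twins b d → ¬ Twins c d → ⊥
    twin-free-four-absurd v≢a v≢b v≢c v≢d ¬ab ¬ac ¬ad ¬bc ¬bd ¬cd
      with tripleCond⇒twinsModulo tc (¬twins⇒≢ ¬ab) (¬twins⇒≢ ¬ac) (¬twins⇒≢ ¬bc)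
    ... | inj₁ ab∣c        =
      twinsModulo-absurd v≢a v≢b v≢c v≢d ¬ab ¬ac ¬ad ¬bc ¬bd ¬cd ab∣c
    ... | inj₂ (inj₁ ac∣b) =
      twinsModulo-absurd v≢a v≢c v≢b v≢d ¬ac ¬ab ¬ad (¬twins-sym ¬bc) ¬cd ¬bd ac∣b
    ... | inj₂ (inj₂ bc∣a) =
      twinsModulo-absurd v≢b v≢c v≢a v≢d ¬bc (¬twins-sym ¬ab) ¬bd (¬twins-sym ¬ac) ¬cd ¬ad bc∣a

  -- Resolving sets

  Resolved : ℕ → Subset n → Fin n → Fin n → Set
  Resolved r S x y = ∃ λ v → v ∈ S × distR G r v x ≢ distR G r v y

  resolved-sym : ∀ {r S x y} → Resolved r S x y → Resolved r S y x
  resolved-sym (v , v∈S , differ) = v , v∈S , ≢-sym differ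

  resolving-from-outside : ∀ {r S} → (∀ {x y} → x ∉ S → y ∉ S → x ≢ y → Resolved r S x y) →
    IsResolving G r S
  resolving-from-outside {r} {S} resolved x y x≢y with x ∈? S | y ∈? S
  ... | yes x∈S | _       = x , x∈S , λ e → distR-≢0 r x≢y (trans (sym e) (distR-refl r x))
  ... | no  _   | yes y∈S = y , y∈S , λ e → distR-≢0 r (≢-sym x≢y) (trans e (distR-refl r y))
  ... | no  x∉S | no  y∉S = resolved x∉S y∉S x≢y

  unresolved-absurd : ∀ {r S x y} → IsResolving G r S → x ≢ y →
    (∀ {v} → v ∈ S → distR G r v x ≡ distR G r v y) → ⊥
  unresolved-absurd res x≢y same = let _ , v∈S , differ = res _ _ x≢y in differ (same v∈S)

  resolving⇒¬twins : ∀ {r S x y} → IsResolving G r S → x ∉ S → y ∉ S → x ≢ y → ¬ Twins x y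
  resolving⇒¬twins {r} {S} res x∉S y∉S x≢y twins =
    unresolved-absurd {r} {S} res x≢y λ v∈S →
      distR-twins twins (∈∉⇒≢ v∈S x∉S) (∈∉⇒≢ v∈S y∉S) r

  resolving₁⇒¬twinsModulo : ∀ {S x y z} → IsResolving G 1 S → x ∉ S → y ∉ S → z ∉ S → x ≢ y →
    ¬ TwinsModulo x y z
  resolving₁⇒¬twinsModulo {S} res x∉S y∉S z∉S x≢y xy∣z =
    unresolved-absurd {1} {S} res x≢y λ {v} v∈S →
      let v≢x = ∈∉⇒≢ v∈S x∉S ; v≢y = ∈∉⇒≢ v∈S y∉S in
      Equivalence.from (distR₁-≡⇔adj-≡ v≢x v≢y)
        (trans (symm G v _) (trans (xy∣z v v≢x v≢y (∈∉⇒≢ v∈S z∉S)) (symm G _ v)))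

  resolving₀-bound : ∀ S → IsResolving G 0 S → n ∸ 1 ≤ ∣ S ∣
  resolving₀-bound S res = outside-bound 0 S λ out → let open Outside out in
    unresolved-absurd {0} {S} res (point-≢ {0F} {1F} λ ()) λ v∈S →
      trans (distR₀-≢ (∈∉⇒≢ v∈S (point∉ 0F))) (sym (distR₀-≢ (∈∉⇒≢ v∈S (point∉ 1F))))

  module _ (tc : TripleCond G) where

    resolving₁-three-outside-absurd : ∀ {S a b c} → IsResolving G 1 S → a ∉ S → b ∉ S → c ∉ S →
      a ≢ b → a ≢ c → b ≢ c → ⊥
    resolving₁-three-outside-absurd {S} res a∉S b∉S c∉S a≢b a≢c b≢c
      with tripleCond⇒twinsModulo tc a≢b a≢c b≢c
    ... | inj₁ ab∣c        = resolving₁⇒¬twinsModulo {S} res a∉S b∉S c∉S a≢b ab∣c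
    ... | inj₂ (inj₁ ac∣b) = resolving₁⇒¬twinsModulo {S} res a∉S c∉S b∉S a≢c ac∣b
    ... | inj₂ (inj₂ bc∣a) = resolving₁⇒¬twinsModulo {S} res b∉S c∉S a∉S b≢c bc∣a

    resolving₁-bound : ∀ S → IsResolving G 1 S → n ∸ 1 ≤ 1 + ∣ S ∣
    resolving₁-bound S res = outside-bound 1 S λ out → let open Outside out in
      resolving₁-three-outside-absurd {S} res (point∉ 0F) (point∉ 1F) (point∉ 2F)
        (point-≢ λ ()) (point-≢ λ ()) (point-≢ λ ())

    resolving₂-bound : ∀ {r} S → IsResolving G r S → n ∸ 1 ≤ 2 + ∣ S ∣
    resolving₂-bound {r} S res = outside-bound 2 S λ out → let open Outside out in
      let v , v∈S , _ = res (point 0F) (point 1F) (point-≢ λ ())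
          v≢ : ∀ i → v ≢ point i
          v≢ i = ∈∉⇒≢ v∈S (point∉ i)
          ¬twins : ∀ i j → i ≢ j → ¬ Twins (point i) (point j)
          ¬twins i j i≢j = resolving⇒¬twins {r} {S} res (point∉ i) (point∉ j) (point-≢ i≢j)
      in twin-free-four-absurd tc (v≢ 0F) (v≢ 1F) (v≢ 2F) (v≢ 3F)
           (¬twins 0F 1F λ ()) (¬twins 0F 2F λ ()) (¬twins 0F 3F λ ())
           (¬twins 1F 2F λ ()) (¬twins 1F 3F λ ()) (¬twins 2F 3F λ ())

    resolving-bound : ∀ r S → IsResolving G r S → n ∸ 1 ≤ r + ∣ S ∣
    resolving-bound 0             S res = resolving₀-bound S res
    resolving-bound 1             S res = resolving₁-bound S res
    resolving-bound (suc (suc r)) S res =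
      ≤-trans (resolving₂-bound {suc (suc r)} S res) (+-monoˡ-≤ ∣ S ∣ (s≤s (s≤s z≤n)))

  Separated : Fin n → Fin n → Fin n → Set
  Separated x y z = ∃ λ w → w ≢ x × w ≢ y × w ≢ z × adj G x w ≢ adj G y w

  twinsModulo⊎separated : ∀ x y z → TwinsModulo x y z ⊎ Separated x y z
  twinsModulo⊎separated x y z with any? (λ w →
    ¬? (w ≟ x) ×-dec ¬? (w ≟ y) ×-dec ¬? (w ≟ z) ×-dec ¬? (adj G x w Bool.≟ adj G y w))
  ... | yes separated  = inj₂ separated
  ... | no  ¬separated = inj₁ λ w w≢x w≢y w≢z → decidable-stable (adj G x w Bool.≟ adj G y w)
                           λ xw≢yw → ¬separated (w , w≢x , w≢y , w≢z , xw≢yw)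

  separated⇒≢ : ∀ {x y z} → Separated x y z → x ≢ y
  separated⇒≢ (_ , _ , _ , _ , xw≢yw) refl = xw≢yw refl

  separated⇒resolved₁ : ∀ {S x y z} → (∀ {w} → w ≢ x → w ≢ y → w ≢ z → w ∈ S) →
    Separated x y z → Resolved 1 S x y
  separated⇒resolved₁ ∈S (w , w≢x , w≢y , w≢z , xw≢yw) = w , ∈S w≢x w≢y w≢z , λ e →
    xw≢yw (trans (symm G _ w) (trans (Equivalence.to (distR₁-≡⇔adj-≡ w≢x w≢y) e) (symm G w _)))

  separated-triple⇒resolving₁ : ∀ {a b c} → Separated a b c → Separated a c b → Separated b c a →
    IsResolving G 1 (∁ (⁅ a ⁆ ∪ ⁅ b ⁆ ∪ ⁅ c ⁆))
  separated-triple⇒resolving₁ {a} {b} {c} ab-sep ac-sep bc-sep =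
    resolving-from-outside {1} {S} λ x∉S y∉S →
      resolve (x∈⁅a⁆∪⁅b⁆∪⁅c⁆⁻ (x∉∁p⇒x∈p x∉S)) (x∈⁅a⁆∪⁅b⁆∪⁅c⁆⁻ (x∉∁p⇒x∈p y∉S))
    where
    S : Subset n
    S = ∁ (⁅ a ⁆ ∪ ⁅ b ⁆ ∪ ⁅ c ⁆)
    ∈S : ∀ {w} → w ≢ a → w ≢ b → w ≢ c → w ∈ S
    ∈S w≢a w≢b w≢c = x∉p⇒x∈∁p (x∉⁅a⁆∪⁅b⁆∪⁅c⁆ w≢a w≢b w≢c)
    ab : Resolved 1 S a b
    ab = separated⇒resolved₁ ∈S ab-sep
    ac : Resolved 1 S a c
    ac = separated⇒resolved₁ (λ w≢a w≢c w≢b → ∈S w≢a w≢b w≢c) ac-sep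
    bc : Resolved 1 S b c
    bc = separated⇒resolved₁ (λ w≢b w≢c w≢a → ∈S w≢a w≢b w≢c) bc-sep
    resolve : ∀ {x y} → x ≡ a ⊎ x ≡ b ⊎ x ≡ c → y ≡ a ⊎ y ≡ b ⊎ y ≡ c → x ≢ y →
      Resolved 1 S x y
    resolve (inj₁ refl)        (inj₁ refl)        x≢x = ⊥-elim (x≢x refl)
    resolve (inj₁ refl)        (inj₂ (inj₁ refl)) _   = ab
    resolve (inj₁ refl)        (inj₂ (inj₂ refl)) _   = ac
    resolve (inj₂ (inj₁ refl)) (inj₁ refl)        _   = resolved-sym {1} {S} ab
    resolve (inj₂ (inj₁ refl)) (inj₂ (inj₁ refl)) x≢x = ⊥-elim (x≢x refl)
    resolve (inj₂ (inj₁ refl)) (inj₂ (inj₂ refl)) _   = bc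
    resolve (inj₂ (inj₂ refl)) (inj₁ refl)        _   = resolved-sym {1} {S} ac
    resolve (inj₂ (inj₂ refl)) (inj₂ (inj₁ refl)) _   = resolved-sym {1} {S} bc
    resolve (inj₂ (inj₂ refl)) (inj₂ (inj₂ refl)) x≢x = ⊥-elim (x≢x refl)

  resolving? : ∀ r S → Dec (IsResolving G r S)
  resolving? r S = all? λ x → all? λ y → ¬? (x ≟ y) →-dec
    any? λ v → (v ∈? S) ×-dec ¬? (distR G r v x ℕ.≟ distR G r v y)

  dimR-exists : ∀ {r} S → IsResolving G r S → ∃ λ d → IsDimR G r d × d ≤ ∣ S ∣
  dimR-exists {r} S res =
    let d , resolving-of-size-d , minimal = least sized? (S , res , refl)
    in d , (resolving-of-size-d , λ S′ res′ → minimal (S′ , res′ , refl))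
         , minimal (S , res , refl)
    where
    sized? : ∀ d → Dec (∃ λ S → IsResolving G r S × ∣ S ∣ ≡ d)
    sized? d = anySubset? λ S → resolving? r S ×-dec ∣ S ∣ ℕ.≟ d

  separated-triple⇒dim₁≤n∸3 : ∀ {a b c} → Separated a b c → Separated a c b → Separated b c a →
    ∃ λ d → IsDimR G 1 d × d ≤ n ∸ 3
  separated-triple⇒dim₁≤n∸3 {a} {b} {c} ab-sep ac-sep bc-sep =
    let d , dim₁ , d≤∣S∣ = dimR-exists {1} (∁ (⁅ a ⁆ ∪ ⁅ b ⁆ ∪ ⁅ c ⁆))
                             (separated-triple⇒resolving₁ ab-sep ac-sep bc-sep)
    in d , dim₁ , ≤-trans d≤∣S∣
         (∣∁⁅a⁆∪⁅b⁆∪⁅c⁆∣≤n∸3 (separated⇒≢ ab-sep) (separated⇒≢ ac-sep) (separated⇒≢ bc-sep))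

  ∁⁅z⁆-resolving : ∀ r z → IsResolving G r (∁ ⁅ z ⁆)
  ∁⁅z⁆-resolving r z = resolving-from-outside {r} {∁ ⁅ z ⁆} λ x∉S y∉S x≢y →
    ⊥-elim (x≢y (trans (x∉∁⁅y⁆⇒x≡y x∉S) (sym (x∉∁⁅y⁆⇒x≡y y∉S))))

  isDimR₀ : Fin n → IsDimR G 0 (n ∸ 1)
  isDimR₀ z = (∁ ⁅ z ⁆ , ∁⁅z⁆-resolving 0 z , ∣∁⁅x⁆∣≡n∸1 z) , resolving₀-bound

mainTheorem6 : (n : ℕ) → 3 ≤ n → (G : Graph n) →
    IsThDim G (n ∸ 1) ⇔ TripleCond G
mainTheorem6 _ (s≤s (s≤s (s≤s {n = m} _))) G = mk⇔ tripleCond thDim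
  where
  twinCond : ∀ {x y z} → TwinsModulo G x y z → TwinCond G x y z
  twinCond = Equivalence.from (twinCond⇔twinsModulo G)

  tripleCond : IsThDim G (2 + m) → TripleCond G
  tripleCond (_ , th-minimal) a b c _ _ _
    with twinsModulo⊎separated G a b c | twinsModulo⊎separated G a c b
       | twinsModulo⊎separated G b c a
  ... | inj₁ ab∣c     | _           | _           = inj₁ (twinCond ab∣c)
  ... | inj₂ _        | inj₁ ac∣b   | _           = inj₂ (inj₁ (twinCond ac∣b))
  ... | inj₂ _        | inj₂ _      | inj₁ bc∣a   = inj₂ (inj₂ (twinCond bc∣a))
  ... | inj₂ ab-sep   | inj₂ ac-sep | inj₂ bc-sep =
    let d , dim₁ , d≤m = separated-triple⇒dim₁≤n∸3 G ab-sep ac-sep bc-sep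
    in ⊥-elim (1+n≰n (≤-trans (s≤s⁻¹ (th-minimal 1 d dim₁)) d≤m))

  thDim : TripleCond G → IsThDim G (2 + m)
  thDim tc = (0 , 2 + m , isDimR₀ G Fin.zero , refl)
           , λ { r _ ((S , res , refl) , _) → resolving-bound G tc r S res }
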